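{- Let $F,G:\mathbf{Sets}\to\mathbf{Sets}$ be functors and $\alpha:F\Rightarrow G$ a natural transformation all of whose components are surjective. Let $b_1:X_1\to GX_1$, $b_2:X_2\to GX_2$ be $G$-coalgebras and $a_1:X_1\to FX_1$, $a_2:X_2\to FX_2$ maps with $b_1=\alpha_{X_1}\circ a_1$ and $b_2=\alpha_{X_2}\circ a_2$. Then a relation $R\subseteq X_1\times X_2$ is a $G$-bisimulation between $b_1$ and $b_2$ if and only if it is an $\equiv^\alpha$-simulation between $a_1$ and $a_2$.
   Context: For a functor $F$ and $R\subseteq X_1\times X_2$ with projections $r_1,r_2$, $\mathrm{Rel}(F)(R)=\{(u,v)\in FX_1\times FX_2\mid\exists w\in FR.\ Fr_1(w)=u,\ Fr_2(w)=v\}$. $R$ is an $F$-bisimulation between coalgebras $c:X_1\to FX_1$ and $d:X_2\to FX_2$ if $(x,y)\in R$ implies $(c(x),d(y))\in\mathrm{Rel}(F)(R)$. An order on $F$ is a family of preorders $\sqsubseteq_X\subseteq FX\times FX$ such that for all $f:X\to Y$, $u\sqsubseteq_X u'$ implies $Ff(u)\sqsubseteq_Y Ff(u')$. Given such an order, $R$ is a $\sqsubseteq$-simulation between $c$ and $d$ if $(x,y)\in R$ implies $(c(x),d(y))\in\{(u,v)\mid\exists w\in FR.\ u\sqsubseteq Fr_1(w)\wedge Fr_2(w)\sqsubseteq v\}$. The kernel $\equiv^\alpha$ is the order on $F$ given by $u_1\equiv^\alpha_X u_2$ iff $\alpha_X(u_1)=\alpha_X(u_2)$. A natural transformation satisfies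 $Gf\circ\alpha_X=\alpha_Y\circ Ff$. -}

module Defs where

open import Data.Product using (Σ; Σ-syntax; ∃; ∃-syntax; _×_; _,_; proj₁; proj₂)
open import Relation.Binary.PropositionalEquality using (_≡_)
open import Function using (_∘_; id)
open import Relation.Binary.Core using (Rel)
open import Relation.Binary.Structures using (IsPreorder)
import Agda.Primitive

record SetFunctor : Set₁ where
  field
    F₀      : Set → Set
    fmap    : {X Y : Set} → (X → Y) → F₀ X → F₀ Y
    fmap-id : {X : Set} (u : F₀ X) → fmap (id {A = X}) u ≡ u
    fmap-∘  : {X Y Z : Set} (g : Y → Z) (f : X → Y) (u : F₀ X) →
              fmap (g ∘ f) u ≡ fmap g (fmap f u)
open SetFunctor public

record NatTrans (F G : SetFunctor) : Set₁ where
  field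
    component  : (X : Set) → F₀ F X → F₀ G X
    naturality : {X Y : Set} (f : X → Y) (u : F₀ F X) →
                 fmap G f (component X u) ≡ component Y (fmap F f u)
open NatTrans public

Surjective : {A B : Set} → (A → B) → Set
Surjective {A} f = ∀ y → ∃[ x ] f x ≡ y

-- A relation R ⊆ X₁ × X₂, as a predicate; the relation as a set and its projections.
Relation : Set → Set → Set₁
Relation X₁ X₂ = X₁ → X₂ → Set

Graph : {X₁ X₂ : Set} → Relation X₁ X₂ → Set
Graph {X₁} {X₂} R = Σ[ p ∈ X₁ × X₂ ] R (proj₁ p) (proj₂ p)

r₁ : {X₁ X₂ : Set} {R : Relation X₁ X₂} → Graph R → X₁
r₁ ((x , _) , _) = x

r₂ : {X₁ X₂ : Set} {R : Relation X₁ X₂} → Graph R → X₂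
r₂ ((_ , y) , _) = y

RelLift : (F : SetFunctor) {X₁ X₂ : Set} → Relation X₁ X₂ → F₀ F X₁ → F₀ F X₂ → Set
RelLift F {X₁} {X₂} R u v =
  ∃[ w ] (fmap F (r₁ {R = R}) w ≡ u × fmap F (r₂ {R = R}) w ≡ v)

IsBisimulation : (F : SetFunctor) {X₁ X₂ : Set} →
                 (X₁ → F₀ F X₁) → (X₂ → F₀ F X₂) → Relation X₁ X₂ → Set
IsBisimulation F c d R = ∀ x y → R x y → RelLift F R (c x) (d y)

record FunctorOrder (F : SetFunctor) : Set₁ where
  field
    _⊑_        : (X : Set) → Rel (F₀ F X) Agda.Primitive.lzero
    isPreorder : (X : Set) → IsPreorder _≡_ (_⊑_ X)
    monotone   : {X Y : Set} (f : X → Y) {u u′ : F₀ F X} →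
                 _⊑_ X u u′ → _⊑_ Y (fmap F f u) (fmap F f u′)
open FunctorOrder public

IsSimulation : (F : SetFunctor) (O : FunctorOrder F) {X₁ X₂ : Set} →
               (X₁ → F₀ F X₁) → (X₂ → F₀ F X₂) → Relation X₁ X₂ → Set
IsSimulation F O {X₁} {X₂} c d R =
  ∀ x y → R x y →
    ∃[ w ] (_⊑_ O X₁ (c x) (fmap F (r₁ {R = R}) w) ×
            _⊑_ O X₂ (fmap F (r₂ {R = R}) w) (d y))

kernelOrder : {F G : SetFunctor} → NatTrans F G → FunctorOrder F
kernelOrder {F} {G} α = record
  { _⊑_ = λ X u₁ u₂ → component α X u₁ ≡ component α X u₂
  ; isPreorder = λ X → record
      { isEquivalence = Eq.isEquivalence
      ; reflexive = λ { Eq.refl → Eq.refl }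
      ; trans = Eq.trans }
  ; monotone = λ {X} {Y} f {u} {u′} e →
      Eq.trans (Eq.sym (naturality α f u))
        (Eq.trans (Eq.cong (fmap G f) e) (naturality α f u′))
  }
  where import Relation.Binary.PropositionalEquality as Eq

{-# OPTIONS --safe #-}
-- Naturality sends a witness w ∈ F R of the ≡^α-lifting to the witness α_R w ∈ G R of
-- Rel(G)(R); conversely, surjectivity of α_R pulls a witness in G R back to F R.
module Submission where

open import Defs
open import Data.Product using (_×_; _,_; ∃-syntax)
open import Relation.Binary.PropositionalEquality using (_≡_; sym; trans; cong)
open import Function.Bundles using (_⇔_; mk⇔; Equivalence)

LaxRelLift : (F : SetFunctor) (O : FunctorOrder F) {X₁ X₂ : Set} →
             Relation X₁ X₂ → F₀ F X₁ → F₀ F X₂ → Set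
LaxRelLift F O {X₁} {X₂} R u v =
  ∃[ w ] (_⊑_ O X₁ u (fmap F (r₁ {R = R}) w) × _⊑_ O X₂ (fmap F (r₂ {R = R}) w) v)

module _ {F G : SetFunctor} (α : NatTrans F G) {X₁ X₂ : Set} (R : Relation X₁ X₂) where

  laxRelLift-kernel⇒relLift : ∀ {u v} → LaxRelLift F (kernelOrder α) R u v →
                              RelLift G R (component α X₁ u) (component α X₂ v)
  laxRelLift-kernel⇒relLift (w , αu≡αFr₁w , αFr₂w≡αv) =
    component α (Graph R) w ,
    trans (naturality α r₁ w) (sym αu≡αFr₁w) ,
    trans (naturality α r₂ w) αFr₂w≡αv

  relLift⇒laxRelLift-kernel : Surjective (component α (Graph R)) →
                              ∀ {u v} → RelLift G R (component α X₁ u) (component α X₂ v) →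
                              LaxRelLift F (kernelOrder α) R u v
  relLift⇒laxRelLift-kernel surj (w , Gr₁w≡αu , Gr₂w≡αv) with surj w
  ... | w′ , αw′≡w =
    w′ ,
    trans (sym Gr₁w≡αu) (trans (cong (fmap G r₁) (sym αw′≡w)) (naturality α r₁ w′)) ,
    trans (sym (naturality α r₂ w′)) (trans (cong (fmap G r₂) αw′≡w) Gr₂w≡αv)

  relLift⇔laxRelLift-kernel : Surjective (component α (Graph R)) → ∀ u v →
                              RelLift G R (component α X₁ u) (component α X₂ v) ⇔
                              LaxRelLift F (kernelOrder α) R u v
  relLift⇔laxRelLift-kernel surj u v =
    mk⇔ (relLift⇒laxRelLift-kernel surj) laxRelLift-kernel⇒relLift

theorem2 : (F G : SetFunctor) (α : NatTrans F G) →
    ((X : Set) → Surjective (component α X)) →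
    {X₁ X₂ : Set} (b₁ : X₁ → F₀ G X₁) (b₂ : X₂ → F₀ G X₂)
    (a₁ : X₁ → F₀ F X₁) (a₂ : X₂ → F₀ F X₂) →
    (∀ x → b₁ x ≡ component α X₁ (a₁ x)) →
    (∀ x → b₂ x ≡ component α X₂ (a₂ x)) →
    (R : Relation X₁ X₂) →
    IsBisimulation G b₁ b₂ R ⇔ IsSimulation F (kernelOrder α) a₁ a₂ R
theorem2 F G α surj b₁ b₂ a₁ a₂ b₁≡αa₁ b₂≡αa₂ R =
  mk⇔ (λ bis x y r → Equivalence.to (pointwise x y) (bis x y r))
      (λ sim x y r → Equivalence.from (pointwise x y) (sim x y r))
  where
  pointwise : ∀ x y → RelLift G R (b₁ x) (b₂ y) ⇔ LaxRelLift F (kernelOrder α) R (a₁ x) (a₂ y)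
  pointwise x y rewrite b₁≡αa₁ x | b₂≡αa₂ y =
    relLift⇔laxRelLift-kernel α R (surj (Graph R)) (a₁ x) (a₂ y)
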